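{- Let $\mathbf u$ be a simple Parry sequence with parameters $m\ge2$, $t_1,\dots,t_m$, and assume (1) $t_i\cdots t_{m-2}(t_{m-1}+1)0^{\omega}\prec_{\mathrm{lex}}t_1t_2\cdots t_m0^{\omega}$ for all $i\in\{2,\dots,m-2\}$; (2) $t_1>\max\{t_{m-1},t_m\}$. Then: (a) for each $n\in\mathbb N$, $n\le m-1$, every prefix of $\mathbf u$ of length $\ell\in[U_n,U_{n+1}-1]$ has the attractor $\Gamma_n$; (b) for each $n\in\mathbb N$, $n\ge m$, every prefix of $\mathbf u$ of length $\ell\in[U_n,Z_n]$ has the attractor $\Gamma_{n-1}$; (c) for each $n\in\mathbb N$, $n\ge m$, every prefix of $\mathbf u$ of length $\ell\in[Z_n,U_{n+1}]$ has the attractor $\Gamma_n$.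
   Context: Simple Parry sequence: $m\in\mathbb N$, $m\ge2$, $t_1,\dots,t_m\in\mathbb N$ with $t_1\ge1$, $t_m\ge1$ and $t_it_{i+1}\cdots t_m0^{\omega}\prec_{\mathrm{lex}}t_1t_2\cdots t_m0^{\omega}$ for each $i\in\{2,\dots,m\}$ ($\prec_{\mathrm{lex}}$ is lexicographic order on integer sequences). $\varphi$ is the morphism on $\{0,\dots,m-1\}^*$ with $\varphi(j)=0^{t_{j+1}}(j+1)$ for $0\le j\le m-2$, $\varphi(m-1)=0^{t_m}$, and $\mathbf u$ is its fixed point starting with $0$. Let $u_n=\varphi^n(0)$, $U_n=|u_n|$ for $n\ge0$, and $u_n=\varepsilon$, $U_n=0$ for $n<0$. Set $\Gamma_n=\{U_0-1,\dots,U_n-1\}$ for $0\le n\le m-1$ and $\Gamma_n=\{U_{n-m+1}-1,\dots,U_n-1\}$ for $n\ge m$. For $n\ge m$, $Z_n=|u_nu_{n-m}^{t_1-t_m}u_{n-m-1}^{t_2}\cdots u_{n-2m+1}^{t_m}|$ (after $u_{n-m}^{t_1-t_m}$ come $u_{n-m-i}^{t_{i+1}}$, $i=1,\dots,m-1$). A (string) attractor of a finite word $w=w_0\cdots w_{N-1}$ is a set $\Gamma\subseteq\{0,\dots,N-1\}$ such that every non-empty factor of $w$ has an occurrence $w_i\cdots w_{j-1}$ with $\{i,\dots,j-1\}\cap\Gamma\ne\emptyset$; positions are indexed from $0$. -}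

module Defs where

open import Data.Nat using (ℕ; zero; suc; _+_; _*_; _∸_; _≤_; _<_; _≤ᵇ_; _≡ᵇ_)
open import Data.Bool using (Bool; true; false; if_then_else_)
open import Data.List using (List; []; _∷_; _++_; replicate; concatMap; concat; length; map; upTo; take; drop)
open import Data.List.Membership.Propositional using (_∈_)
open import Data.List.Relation.Unary.All using (All)
open import Data.Product using (Σ; ∃; _×_; _,_)
open import Relation.Binary.PropositionalEquality using (_≡_)

-- Words over ℕ (letters), positions indexed from 0.
Word : Set
Word = List ℕ

_≺lex_ : (ℕ → ℕ) → (ℕ → ℕ) → Set
a ≺lex b = Σ ℕ λ k → ((j : ℕ) → j < k → a j ≡ b j) × (a k < b k)

-- Letter at position k of a finite word (default 0 beyond the end).
at : Word → ℕ → ℕ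
at []       _       = 0
at (x ∷ _)  zero    = x
at (_ ∷ w)  (suc k) = at w k

factor : Word → ℕ → ℕ → Word
factor w i j = take (j ∸ i) (drop i w)

IsAttractor : Word → List ℕ → Set
IsAttractor w Γ =
  All (λ p → p < length w) Γ ×
  ((i j : ℕ) → i < j → j ≤ length w →
     Σ ℕ λ i' → Σ ℕ λ j' →
       (j' ≤ length w) × (factor w i' j' ≡ factor w i j) ×
       (Σ ℕ λ p → (p ∈ Γ) × (i' ≤ p) × (p < j')))

-- Everything below depends on the parameters m and t, where only
-- t 1, …, t m are used (t i stands for t_i).
module Parry (m : ℕ) (t : ℕ → ℕ) where

  tail-seq : ℕ → ℕ → ℕ
  tail-seq i k = if (i + k) ≤ᵇ m then t (i + k) else 0

  mod-seq : ℕ → ℕ → ℕ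
  mod-seq i k =
    if (i + k) ≤ᵇ (m ∸ 2) then t (i + k)
    else (if (i + k) ≡ᵇ (m ∸ 1) then suc (t (m ∸ 1)) else 0)

  IsSimpleParry : Set
  IsSimpleParry =
    (2 ≤ m) × (1 ≤ t 1) × (1 ≤ t m) ×
    ((i : ℕ) → 2 ≤ i → i ≤ m → tail-seq i ≺lex tail-seq 1)

  -- the morphism φ : φ(j) = 0^{t_{j+1}} (j+1) for j ≤ m-2, φ(m-1) = 0^{t_m}
  -- (letters ≥ m do not occur in u; they are sent to ε)
  φ : ℕ → Word
  φ j = if suc (suc j) ≤ᵇ m then replicate (t (suc j)) 0 ++ (suc j ∷ [])
        else (if suc j ≡ᵇ m then replicate (t m) 0 else [])

  φ* : Word → Word
  φ* = concatMap φ

  uw : ℕ → Word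
  uw zero    = 0 ∷ []
  uw (suc n) = φ* (uw n)

  U : ℕ → ℕ
  U n = length (uw n)

  -- u_{n-k} with the convention u_j = ε for j < 0
  uw- : ℕ → ℕ → Word
  uw- n k = if k ≤ᵇ n then uw (n ∸ k) else []

  -- the fixed point u of φ starting with 0:  u_k is the k-th letter of
  -- φ^{k+1}(0) (which has length ≥ k+2 and is a prefix of u)
  u : ℕ → ℕ
  u k = at (uw (suc k)) k

  prefix : ℕ → Word
  prefix ℓ = map u (upTo ℓ)

  Γ : ℕ → List ℕ
  Γ n = if suc n ≤ᵇ m
        then map (λ k → U k ∸ 1) (upTo (suc n))
        else map (λ k → U ((n ∸ m) + suc k) ∸ 1) (upTo m)

  Zw : ℕ → Word
  Zw n = uw n ++ concat (replicate (t 1 ∸ t m) (uw- n m)) ++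
         concat (map (λ i → concat (replicate (t (suc i)) (uw- n (m + i))))
                     (drop 1 (upTo m)))

  Z : ℕ → ℕ
  Z n = length (Zw n)

{-# OPTIONS --safe #-}
module Submission where

-- A word u_{k-1}^{d₀} u_{k-2}^{d₁} ⋯ is a prefix of u as soon as every suffix of d₀ d₁ ⋯ is lexicographically
-- at most t₁ ⋯ t_m.  Hence u_{n+1} is u_n followed by a prefix of u (digits t₁-1, t₂, …, t_m), so
-- u[0, U_{n+1} - 1) has period U_n; and Z_n is u_{n-1} followed by a prefix of u (digits t₁-1, t₂, …, t_{m-1},
-- t₁, …, t_m, admissible by hypotheses (1) and (2)), so u[0, Z_n) has period U_{n-1}.  An attractor of
-- u[0, ℓ₀) containing p - 1 stays one of u[0, ℓ) for ℓ₀ ≤ ℓ as long as u[0, ℓ) has period p: a new factor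
-- either covers p - 1 or is a shifted copy of an older one.  This gives (a) and (b).  For (c), with n = m + d,
-- write Z_n = A V where |A| + t_m U_d = U_n and V begins with u_d^{t₁}.  An occurrence through U_d - 1, the
-- position of Γ_{n-1} missing from Γ_n, is slid by the period U_d inside u_d^{t₁} and copied into V, where it
-- passes through U_n - 1.  The range of (c) is then the beginning of the range of (b) for n + 1.

open import Defs
open import Data.Nat
open import Data.Nat.Properties
open import Data.Nat.GeneralisedArithmetic using (fold; iterate; iterate-is-fold)
open import Data.Nat.Tactic.RingSolver using (solve-∀)
open import Data.Bool using (true; false; if_then_else_; T)
open import Data.List using (List; []; _∷_; _++_; replicate; concat; concatMap; length; map; applyUpTo; upTo; take; drop)
open import Data.List.Properties using (++-assoc; length-++; ++-identityʳ; concatMap-++; map-upTo; length-applyUpTo)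
open import Data.List.Membership.Propositional using (_∈_)
open import Data.List.Membership.Propositional.Properties using (∈-map⁺; ∈-map⁻; ∈-upTo⁺; ∈-upTo⁻)
open import Data.List.Relation.Unary.All as All using (All)
open import Data.Product using (Σ; _×_; _,_; proj₁; proj₂)
open import Data.Sum using (_⊎_; inj₁; inj₂)
open import Data.Empty using (⊥-elim)
open import Data.Unit using (⊤; tt)
open import Function using (_∘′_)
open import Relation.Binary.PropositionalEquality
open import Relation.Binary.Definitions using (tri<; tri≈; tri>)
open import Relation.Nullary using (¬_; yes; no)

if-T : ∀ {A : Set} {b} {x y : A} → T b → (if b then x else y) ≡ x
if-T {b = true} _ = refl

if-¬T : ∀ {A : Set} {b} {x y : A} → ¬ T b → (if b then x else y) ≡ y
if-¬T {b = true}  ¬b = ⊥-elim (¬b tt)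
if-¬T {b = false} _  = refl

_^ʷ_ : Word → ℕ → Word
w ^ʷ c = concat (replicate c w)

length-^ʷ : ∀ w c → length (w ^ʷ c) ≡ c * length w
length-^ʷ w zero    = refl
length-^ʷ w (suc c) = trans (length-++ w) (cong (length w +_) (length-^ʷ w c))

^ʷ-+ : ∀ w a b → w ^ʷ (a + b) ≡ w ^ʷ a ++ w ^ʷ b
^ʷ-+ w zero    b = refl
^ʷ-+ w (suc a) b = trans (cong (w ++_) (^ʷ-+ w a b)) (sym (++-assoc w (w ^ʷ a) (w ^ʷ b)))

^ʷ-sucʳ : ∀ w c → w ^ʷ suc c ≡ w ^ʷ c ++ w
^ʷ-sucʳ w c = trans (cong (w ^ʷ_) (+-comm 1 c))
                    (trans (^ʷ-+ w c 1) (cong (w ^ʷ c ++_) (++-identityʳ w)))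

[]-^ʷ : ∀ c → [] ^ʷ c ≡ []
[]-^ʷ zero    = refl
[]-^ʷ (suc c) = []-^ʷ c

at-++ˡ : ∀ (xs ys : Word) q → q < length xs → at (xs ++ ys) q ≡ at xs q
at-++ˡ (x ∷ xs) ys zero    _        = refl
at-++ˡ (x ∷ xs) ys (suc q) (s≤s lt) = at-++ˡ xs ys q lt

at-++ʳ : ∀ (xs ys : Word) q → at (xs ++ ys) (length xs + q) ≡ at ys q
at-++ʳ []       ys q = refl
at-++ʳ (x ∷ xs) ys q = at-++ʳ xs ys q

applyUpTo-cong : ∀ {A : Set} {f g : ℕ → A} L → (∀ q → q < L → f q ≡ g q) →
                 applyUpTo f L ≡ applyUpTo g L
applyUpTo-cong zero    eq = refl
applyUpTo-cong (suc L) eq = cong₂ _∷_ (eq 0 z<s) (applyUpTo-cong L (λ q lt → eq (suc q) (s<s lt)))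

drop-applyUpTo : ∀ {A : Set} (f : ℕ → A) i n → drop i (applyUpTo f (i + n)) ≡ applyUpTo (λ q → f (i + q)) n
drop-applyUpTo f zero    n = refl
drop-applyUpTo f (suc i) n = drop-applyUpTo (λ q → f (suc q)) i n

take-applyUpTo : ∀ {A : Set} (f : ℕ → A) n r → take n (applyUpTo f (n + r)) ≡ applyUpTo f n
take-applyUpTo f zero    r = refl
take-applyUpTo f (suc n) r = cong (f 0 ∷_) (take-applyUpTo (λ q → f (suc q)) n r)

factor-applyUpTo : ∀ {f : ℕ → ℕ} {ℓ} i L → i + L ≤ ℓ →
                   factor (applyUpTo f ℓ) i (i + L) ≡ applyUpTo (λ q → f (i + q)) L
factor-applyUpTo {f} {ℓ} i L i+L≤ℓ with m≤n⇒∃[o]m+o≡n i+L≤ℓ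
... | r , refl = begin
  take (i + L ∸ i) (drop i (applyUpTo f ((i + L) + r)))   ≡⟨ cong₂ take (m+n∸m≡n i L)
                                                               (cong (drop i ∘′ applyUpTo f) (+-assoc i L r)) ⟩
  take L (drop i (applyUpTo f (i + (L + r))))             ≡⟨ cong (take L) (drop-applyUpTo f i (L + r)) ⟩
  take L (applyUpTo (λ q → f (i + q)) (L + r))            ≡⟨ take-applyUpTo _ L r ⟩
  applyUpTo (λ q → f (i + q)) L                           ∎
  where open ≡-Reasoning

infix 4 _⊑_

_⊑_ : Word → Word → Set
w ⊑ v = Σ Word λ r → v ≡ w ++ r

⊑-refl : ∀ {w} → w ⊑ w
⊑-refl {w} = [] , sym (++-identityʳ w)

⊑-++ : ∀ w r → w ⊑ w ++ r
⊑-++ w r = r , refl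

⊑-trans : ∀ {a b c} → a ⊑ b → b ⊑ c → a ⊑ c
⊑-trans {a} (r , refl) (s , refl) = r ++ s , ++-assoc a r s

⊑-++⁺ : ∀ a {b c} → b ⊑ c → a ++ b ⊑ a ++ c
⊑-++⁺ a {b} (r , refl) = r , sym (++-assoc a b r)

[]⊑ : ∀ w → [] ⊑ w
[]⊑ w = w , refl

⊑-length : ∀ {a b} → a ⊑ b → length a ≤ length b
⊑-length {a} (r , refl) = subst (length a ≤_) (sym (length-++ a)) (m≤m+n _ _)

⊑-at : ∀ {a b} → a ⊑ b → ∀ q → q < length a → at b q ≡ at a q
⊑-at {a} (r , refl) = at-++ˡ a r

^ʷ-⊑ : ∀ w {a b} → a ≤ b → w ^ʷ a ⊑ w ^ʷ b
^ʷ-⊑ w {a} a≤b with m≤n⇒∃[o]m+o≡n a≤b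
... | c , refl = subst (w ^ʷ a ⊑_) (sym (^ʷ-+ w a c)) (⊑-++ (w ^ʷ a) (w ^ʷ c))

length-++-∸1 : ∀ (w E : Word) → length E ≤ 1 → length (w ++ E) ∸ 1 ≤ length w
length-++-∸1 w E |E|≤1 = subst (λ n → n ∸ 1 ≤ length w) (sym (length-++ w))
  (≤-trans (∸-monoˡ-≤ 1 (+-monoʳ-≤ (length w) |E|≤1)) (≤-reflexive (m+n∸n≡m (length w) 1)))

infix 4 _≤lex_

-- Lexicographic order on finite digit strings, both padded with 0^ω.
_≤lex_ : List ℕ → List ℕ → Set
[]      ≤lex e        = ⊤
(c ∷ d) ≤lex []       = c ≡ 0 × d ≤lex []
(c ∷ d) ≤lex (c′ ∷ e) = c < c′ ⊎ (c ≡ c′ × d ≤lex e)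

≤lex-refl : ∀ e → e ≤lex e
≤lex-refl []      = tt
≤lex-refl (c ∷ e) = inj₂ (refl , ≤lex-refl e)

≺lex⇒≤lex : ∀ d e → at d ≺lex at e → d ≤lex e
≺lex⇒≤lex []      e        _                = tt
≺lex⇒≤lex (c ∷ d) []       (zero  , _ , ())
≺lex⇒≤lex (c ∷ d) []       (suc k , _ , lt) = ⊥-elim (n≮0 lt)
≺lex⇒≤lex (c ∷ d) (c′ ∷ e) (zero  , _ , lt) = inj₁ lt
≺lex⇒≤lex (c ∷ d) (c′ ∷ e) (suc k , eqs , lt) =
  inj₂ (eqs 0 z<s , ≺lex⇒≤lex d e (k , (λ j j<k → eqs (suc j) (s<s j<k)) , lt))

≺lex-trans : ∀ {a b c} → a ≺lex b → b ≺lex c → a ≺lex c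
≺lex-trans {a} {b} {c} (k , eqs , lt) (k′ , eqs′ , lt′) with <-cmp k k′
... | tri< k<k′ _ _ = k , (λ j j<k → trans (eqs j j<k) (eqs′ j (<-trans j<k k<k′))) ,
                      <-≤-trans lt (≤-reflexive (eqs′ k k<k′))
... | tri≈ _ refl _ = k , (λ j j<k → trans (eqs j j<k) (eqs′ j j<k)) , <-trans lt lt′
... | tri> _ _ k′<k = k′ , (λ j j<k′ → trans (eqs j (<-trans j<k′ k′<k)) (eqs′ j j<k′)) ,
                      ≤-<-trans (≤-reflexive (eqs k′ k′<k)) lt′

≺lex-respʳ : ∀ {a b c} → (∀ j → b j ≡ c j) → a ≺lex b → a ≺lex c
≺lex-respʳ b≗c (k , eqs , lt) = k , (λ j j<k → trans (eqs j j<k) (b≗c j)) , subst (_ <_) (b≗c k) lt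

≺lex-respˡ : ∀ {a b c} → (∀ j → a j ≡ b j) → b ≺lex c → a ≺lex c
≺lex-respˡ a≗b (k , eqs , lt) = k , (λ j j<k → trans (a≗b j) (eqs j j<k)) , subst (_< _) (sym (a≗b k)) lt

module Factors (u : ℕ → ℕ) where

  IsPrefix : Word → Set
  IsPrefix w = ∀ q → q < length w → at w q ≡ u q

  IsPrefix-⊑ : ∀ {a b} → a ⊑ b → IsPrefix b → IsPrefix a
  IsPrefix-⊑ a⊑b pb q lt = trans (sym (⊑-at a⊑b q lt)) (pb q (<-≤-trans lt (⊑-length a⊑b)))

  Periodic : ℕ → ℕ → Set
  Periodic p N = ∀ q → p + q < N → u (p + q) ≡ u q

  Periodic-≤ : ∀ {p N N′} → N′ ≤ N → Periodic p N → Periodic p N′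
  Periodic-≤ N′≤N per q lt = per q (<-≤-trans lt N′≤N)

  IsPrefix-periodic : ∀ B Y → IsPrefix (B ++ Y) → IsPrefix Y → Periodic (length B) (length B + length Y)
  IsPrefix-periodic B Y pBY pY q lt = begin
    u (length B + q)            ≡⟨ pBY (length B + q) (subst (length B + q <_) (sym (length-++ B)) lt) ⟨
    at (B ++ Y) (length B + q)  ≡⟨ at-++ʳ B Y q ⟩
    at Y q                      ≡⟨ pY q (+-cancelˡ-< (length B) q (length Y) lt) ⟩
    u q                         ∎
    where open ≡-Reasoning

  IsPrefix-^ʷ-periodic : ∀ w {c} → 1 ≤ c → IsPrefix (w ^ʷ c) → Periodic (length w) (c * length w)
  IsPrefix-^ʷ-periodic w {suc c} _ pre =
    subst (Periodic (length w)) (cong (length w +_) (length-^ʷ w c))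
      (IsPrefix-periodic w (w ^ʷ c) pre (IsPrefix-⊑ (^ʷ-⊑ w (n≤1+n c)) pre))

  SameFactor : ℕ → ℕ → ℕ → Set
  SameFactor i′ i L = ∀ q → q < L → u (i′ + q) ≡ u (i + q)

  Occurrence : ℕ → (ℕ → Set) → ℕ → ℕ → Set
  Occurrence ℓ G i L = Σ ℕ λ i′ → i′ + L ≤ ℓ × SameFactor i′ i L ×
                       Σ ℕ λ p → G p × i′ ≤ p × p < i′ + L

  -- IsAttractor of u[0, ℓ), with the attractor given as a predicate and factors compared letter by letter.
  Attractor : ℕ → (ℕ → Set) → Set
  Attractor ℓ G = ∀ i L → 1 ≤ L → i + L ≤ ℓ → Occurrence ℓ G i L

  Attractor-mono : ∀ {ℓ} {G G′ : ℕ → Set} → (∀ {p} → G p → G′ p) → Attractor ℓ G → Attractor ℓ G′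
  Attractor-mono G⊆G′ W i L L≥1 i+L≤ℓ with W i L L≥1 i+L≤ℓ
  ... | i′ , b , same , p , gp , i′≤p , p< = i′ , b , same , p , G⊆G′ gp , i′≤p , p<

  Attractor-zero : ∀ {G} → Attractor 0 G
  Attractor-zero i L L≥1 i+L≤0 = ⊥-elim (n≮0 (≤-trans L≥1 (≤-trans (m≤n+m L i) i+L≤0)))

  Occurrence-≤ : ∀ {ℓ ℓ′ G i L} → ℓ ≤ ℓ′ → Occurrence ℓ G i L → Occurrence ℓ′ G i L
  Occurrence-≤ ℓ≤ℓ′ (i′ , b , same , cover) = i′ , ≤-trans b ℓ≤ℓ′ , same , cover

  Occurrence-resp : ∀ {ℓ G i j L} → SameFactor j i L → Occurrence ℓ G j L → Occurrence ℓ G i L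
  Occurrence-resp j≈i (i′ , b , same , cover) = i′ , b , (λ q q<L → trans (same q q<L) (j≈i q q<L)) , cover

  -- A factor of u[0, ℓ+1) that is not one of u[0, ℓ) ends at ℓ; if it starts after x, the period x + 1
  -- moves it to the left.
  Attractor-suc : ∀ {ℓ G x} → Attractor ℓ G → G x → x ≤ ℓ → Periodic (suc x) (suc ℓ) → Attractor (suc ℓ) G
  Attractor-suc {ℓ} {G} {x} W gx x≤ℓ per i L L≥1 i+L≤1+ℓ with m≤n⇒m<n∨m≡n i+L≤1+ℓ
  ... | inj₁ i+L<1+ℓ = Occurrence-≤ (n≤1+n ℓ) (W i L L≥1 (s≤s⁻¹ i+L<1+ℓ))
  ... | inj₂ i+L≡1+ℓ with i ≤? x
  ...   | yes i≤x = i , i+L≤1+ℓ , (λ _ _ → refl) , x , gx , i≤x , subst (x <_) (sym i+L≡1+ℓ) (s≤s x≤ℓ)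
  ...   | no  i≰x with m≤n⇒∃[o]m+o≡n (≰⇒> i≰x)
  ...     | s , refl = Occurrence-≤ (n≤1+n ℓ) (Occurrence-resp shift (W s L L≥1 s+L≤ℓ))
    where
    1+x+[s+L]≡1+ℓ : suc x + (s + L) ≡ suc ℓ
    1+x+[s+L]≡1+ℓ = trans (sym (+-assoc (suc x) s L)) i+L≡1+ℓ

    s+L≤ℓ : s + L ≤ ℓ
    s+L≤ℓ = s≤s⁻¹ (subst (suc (s + L) ≤_) 1+x+[s+L]≡1+ℓ (s≤s (m≤n+m (s + L) x)))

    shift : SameFactor s (suc x + s) L
    shift q q<L = begin
      u (s + q)             ≡⟨ per (s + q) (<-≤-trans (+-monoʳ-< (suc x) (+-monoʳ-< s q<L))
                                                      (≤-reflexive 1+x+[s+L]≡1+ℓ)) ⟨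
      u (suc x + (s + q))   ≡⟨ cong u (+-assoc (suc x) s q) ⟨
      u (suc x + s + q)     ∎
      where open ≡-Reasoning

  Attractor-extend : ∀ {ℓ₀ ℓ₁ G x} → Attractor ℓ₀ G → G x → x ≤ ℓ₀ → Periodic (suc x) ℓ₁ →
                     ∀ {ℓ} → ℓ₀ ≤ ℓ → ℓ ≤ ℓ₁ → Attractor ℓ G
  Attractor-extend W gx x≤ℓ₀ per ℓ₀≤ℓ ℓ≤ℓ₁ with m≤n⇒m<n∨m≡n ℓ₀≤ℓ
  ... | inj₂ refl = W
  Attractor-extend W gx x≤ℓ₀ per {suc ℓ} _ ℓ≤ℓ₁ | inj₁ (s≤s ℓ₀≤ℓ) =
    Attractor-suc (Attractor-extend W gx x≤ℓ₀ per ℓ₀≤ℓ (<⇒≤ ℓ≤ℓ₁))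
                  gx (≤-trans x≤ℓ₀ ℓ₀≤ℓ) (Periodic-≤ ℓ≤ℓ₁ per)

  Through : ℕ → ℕ → ℕ → ℕ → Set
  Through ℓ i L y = Σ ℕ λ a → a + L ≤ ℓ × SameFactor a i L × a ≤ y × y < a + L

  Through-step : ∀ {p N ℓ i L y} → Periodic p N → N ≤ ℓ → y + p + p ≤ N →
                 Through ℓ i L y → Through ℓ i L (y + p)
  Through-step {p} {N} {ℓ} {i} {L} {y} per N≤ℓ y+2p≤N (a , a+L≤ℓ , same , a≤y , y<a+L) with y + p <? a + L
  ... | yes y+p<a+L = a , a+L≤ℓ , same , ≤-trans a≤y (m≤m+n y p) , y+p<a+L
  ... | no  y+p≮a+L = a + p , ≤-trans a+p+L≤N N≤ℓ , shifted , +-monoˡ-≤ p a≤y ,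
                      <-≤-trans (+-monoˡ-< p y<a+L) (≤-reflexive (swap a L p))
    where
    swap : ∀ a b c → a + b + c ≡ a + c + b
    swap = solve-∀

    a+p+L≤N : a + p + L ≤ N
    a+p+L≤N = ≤-trans (≤-reflexive (swap a p L)) (≤-trans (+-monoˡ-≤ p (≮⇒≥ y+p≮a+L)) y+2p≤N)

    a+p+q≡p+[a+q] : ∀ q → a + p + q ≡ p + (a + q)
    a+p+q≡p+[a+q] q = trans (swap a p q) (+-comm (a + q) p)

    shifted : SameFactor (a + p) i L
    shifted q q<L = begin
      u (a + p + q)     ≡⟨ cong u (a+p+q≡p+[a+q] q) ⟩
      u (p + (a + q))   ≡⟨ per (a + q) (subst (_< N) (a+p+q≡p+[a+q] q) (<-≤-trans (+-monoʳ-< (a + p) q<L) a+p+L≤N)) ⟩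
      u (a + q)         ≡⟨ same q q<L ⟩
      u (i + q)         ∎
      where open ≡-Reasoning

  Through-climb : ∀ {p N ℓ i L y} → Periodic p N → N ≤ ℓ → ∀ k → y + k * p + p ≤ N →
                  Through ℓ i L y → Through ℓ i L (y + k * p)
  Through-climb {p} {N} {ℓ} {i} {L} {y} per N≤ℓ zero _ th = subst (Through ℓ i L) (sym (+-identityʳ y)) th
  Through-climb {p} {N} {ℓ} {i} {L} {y} per N≤ℓ (suc k) bound th =
    subst (Through ℓ i L) (unfold y k p) (Through-step {y = y + k * p} per N≤ℓ bound′ (Through-climb per N≤ℓ k
      (≤-trans (m≤m+n _ p) bound′) th))
    where
    unfold : ∀ y k p → y + k * p + p ≡ y + suc k * p
    unfold = solve-∀

    bound′ : y + k * p + p + p ≤ N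
    bound′ = subst (λ z → z + p ≤ N) (sym (unfold y k p)) bound

  -- An occurrence through P either reaches P₁, or lies in u[0, ℓ′); there the period p slides it until it
  -- passes through P + τ p, and the copy of u[0, ℓ′) at c carries it to c + (P + τ p).
  Attractor-relocate : ∀ {ℓ G G′ P P₁ p N ℓ′ c} τ → Attractor ℓ G → (∀ {q} → G q → G′ q ⊎ q ≡ P) →
    G′ P₁ → P ≤ P₁ → P₁ ≤ ℓ′ → Periodic p N → P + τ * p + p ≤ N → N ≤ ℓ′ →
    Periodic c (c + ℓ′) → c + ℓ′ ≤ ℓ → G′ (c + (P + τ * p)) → Attractor ℓ G′
  Attractor-relocate {ℓ} {G} {G′} {P} {P₁} {p} {N} {ℓ′} {c} τ
                     W G⊆G′∪P gP₁ P≤P₁ P₁≤ℓ′ per bound N≤ℓ′ perc c+ℓ′≤ℓ gQ i L L≥1 i+L≤ℓ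
                     with W i L L≥1 i+L≤ℓ
  ... | a , a+L≤ℓ , same , q , gq , a≤q , q<a+L with G⊆G′∪P gq
  ...   | inj₁ g′q  = a , a+L≤ℓ , same , q , g′q , a≤q , q<a+L
  ...   | inj₂ refl with P₁ <? a + L
  ...     | yes P₁<a+L = a , a+L≤ℓ , same , P₁ , gP₁ , ≤-trans a≤q P≤P₁ , P₁<a+L
  ...     | no  P₁≮a+L = copy (Through-climb per N≤ℓ′ τ bound (a , a+L≤ℓ′ , same , a≤q , q<a+L))
    where
    a+L≤ℓ′ : a + L ≤ ℓ′
    a+L≤ℓ′ = ≤-trans (≮⇒≥ P₁≮a+L) P₁≤ℓ′

    copy : Through ℓ′ i L (P + τ * p) → Occurrence ℓ G′ i L
    copy (b , b+L≤ℓ′ , same′ , b≤y , y<b+L) =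
      c + b , ≤-trans (≤-reflexive (+-assoc c b L)) (≤-trans (+-monoʳ-≤ c b+L≤ℓ′) c+ℓ′≤ℓ) ,
      (λ q q<L → trans (cong u (+-assoc c b q))
                       (trans (perc (b + q) (+-monoʳ-< c (<-≤-trans (+-monoʳ-< b q<L) b+L≤ℓ′))) (same′ q q<L))) ,
      c + (P + τ * p) , gQ , +-monoʳ-≤ c b≤y ,
      <-≤-trans (+-monoʳ-< c y<b+L) (≤-reflexive (sym (+-assoc c b L)))

  prefix-length : ∀ ℓ → length (map u (upTo ℓ)) ≡ ℓ
  prefix-length ℓ = trans (cong length (map-upTo u ℓ)) (length-applyUpTo u ℓ)

  Attractor⇒IsAttractor : ∀ {ℓ G Γ} → All (_< ℓ) Γ → (∀ {p} → G p → p ∈ Γ) → Attractor ℓ G →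
                          IsAttractor (map u (upTo ℓ)) Γ
  Attractor⇒IsAttractor {ℓ} {G} {Γ} Γ<ℓ G⊆Γ W = subst (λ n → All (_< n) Γ) (sym (prefix-length ℓ)) Γ<ℓ , occurs
    where
    factor-prefix : ∀ i L → i + L ≤ ℓ → factor (map u (upTo ℓ)) i (i + L) ≡ applyUpTo (λ q → u (i + q)) L
    factor-prefix i L i+L≤ℓ = trans (cong (λ w → factor w i (i + L)) (map-upTo u ℓ)) (factor-applyUpTo i L i+L≤ℓ)

    occurs : ∀ i j → i < j → j ≤ length (map u (upTo ℓ)) →
             Σ ℕ λ i′ → Σ ℕ λ j′ → (j′ ≤ length (map u (upTo ℓ))) ×
               (factor (map u (upTo ℓ)) i′ j′ ≡ factor (map u (upTo ℓ)) i j) ×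
               (Σ ℕ λ p → (p ∈ Γ) × (i′ ≤ p) × (p < j′))
    occurs i j i<j j≤ with m≤n⇒∃[o]m+o≡n (<⇒≤ i<j)
    ... | L , refl with W i L (+-cancelˡ-≤ i 1 L (subst (_≤ i + L) (+-comm 1 i) i<j)) i+L≤ℓ
      where
      i+L≤ℓ : i + L ≤ ℓ
      i+L≤ℓ = subst (i + L ≤_) (prefix-length ℓ) j≤
    ...   | i′ , i′+L≤ℓ , same , p , gp , i′≤p , p<i′+L =
      i′ , i′ + L , subst (i′ + L ≤_) (sym (prefix-length ℓ)) i′+L≤ℓ ,
      trans (factor-prefix i′ L i′+L≤ℓ)
            (trans (applyUpTo-cong L same) (sym (factor-prefix i L (subst (i + L ≤_) (prefix-length ℓ) j≤)))) ,
      p , G⊆Γ gp , i′≤p , p<i′+L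

module Expansion (m : ℕ) (t : ℕ → ℕ) where
  open Parry m t

  φ-inner : ∀ {j} → suc j < m → φ j ≡ replicate (t (suc j)) 0 ++ suc j ∷ []
  φ-inner 1+j<m = if-T (≤⇒≤ᵇ 1+j<m)

  φ-last : ∀ {j} → suc j ≡ m → φ j ≡ replicate (t m) 0
  φ-last {j} refl = trans (if-¬T (λ h → n≮n (suc j) (≤ᵇ⇒≤ (suc (suc j)) (suc j) h)))
                          (if-T (≡⇒≡ᵇ (suc j) (suc j) refl))

  iterate-++ : ∀ k xs ys → iterate φ* (xs ++ ys) k ≡ iterate φ* xs k ++ iterate φ* ys k
  iterate-++ zero    xs ys = refl
  iterate-++ (suc k) xs ys = trans (cong (λ w → iterate φ* w k) (concatMap-++ φ xs ys))
                                   (iterate-++ k (φ* xs) (φ* ys))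

  iterate-[] : ∀ k → iterate φ* [] k ≡ []
  iterate-[] zero    = refl
  iterate-[] (suc k) = iterate-[] k

  iterate-replicate : ∀ k c x → iterate φ* (replicate c x) k ≡ iterate φ* (x ∷ []) k ^ʷ c
  iterate-replicate k zero    x = iterate-[] k
  iterate-replicate k (suc c) x = trans (iterate-++ k (x ∷ []) (replicate c x))
                                        (cong (iterate φ* (x ∷ []) k ++_) (iterate-replicate k c x))

  uw-iterate : ∀ k → uw k ≡ iterate φ* (0 ∷ []) k
  uw-iterate k = trans (uw≡fold k) (iterate-is-fold (0 ∷ []) φ* k)
    where
    uw≡fold : ∀ k → uw k ≡ fold (0 ∷ []) φ* k
    uw≡fold zero    = refl
    uw≡fold (suc k) = cong φ* (uw≡fold k)

  -- expand k (d₀ ∷ d₁ ∷ ⋯) = u_{k-1}^{d₀} u_{k-2}^{d₁} ⋯, cut off before the index becomes negative.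
  expand : ℕ → List ℕ → Word
  expand zero    _       = []
  expand (suc k) []      = []
  expand (suc k) (c ∷ d) = uw k ^ʷ c ++ expand k d

  expand-[] : ∀ k → expand k [] ≡ []
  expand-[] zero    = refl
  expand-[] (suc k) = refl

  expand-++ : ∀ k d e → expand k (d ++ e) ≡ expand k d ++ expand (k ∸ length d) e
  expand-++ zero    d       e = cong (λ k → expand k e) (sym (0∸n≡0 (length d)))
  expand-++ (suc k) []      e = refl
  expand-++ (suc k) (c ∷ d) e = trans (cong (uw k ^ʷ c ++_) (expand-++ k d e))
                                      (sym (++-assoc (uw k ^ʷ c) (expand k d) _))

  ts : ℕ → ℕ → List ℕ
  ts i zero    = []
  ts i (suc r) = t i ∷ ts (suc i) r

  length-ts : ∀ i r → length (ts i r) ≡ r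
  length-ts i zero    = refl
  length-ts i (suc r) = cong suc (length-ts (suc i) r)

  at-ts-< : ∀ i r j → j < r → at (ts i r) j ≡ t (i + j)
  at-ts-< i (suc r) zero    _         = cong t (sym (+-identityʳ i))
  at-ts-< i (suc r) (suc j) (s≤s j<r) = trans (at-ts-< (suc i) r j j<r) (cong t (sym (+-suc i j)))

  at-ts-≥ : ∀ i r j → r ≤ j → at (ts i r) j ≡ 0
  at-ts-≥ i zero    j       _         = refl
  at-ts-≥ i (suc r) (suc j) (s≤s r≤j) = at-ts-≥ (suc i) r j r≤j

  ts-suc : ∀ i r → ts i (suc r) ≡ ts i r ++ t (i + r) ∷ []
  ts-suc i zero    = cong (λ k → t k ∷ []) (sym (+-identityʳ i))
  ts-suc i (suc r) = cong (t i ∷_) (trans (ts-suc (suc i) r) (cong (λ k → ts (suc i) r ++ t k ∷ []) (sym (+-suc i r))))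

  Residue : ℕ → ℕ → Word → Set
  Residue k j E = length E ≤ 1 × (m ≤ j + k → E ≡ [])

  -- The residue E is the letter j + k while j + k < m.
  iterate-letter : ∀ k j → j < m →
                   Σ Word λ E → iterate φ* (j ∷ []) k ≡ expand k (ts (suc j) (m ∸ j)) ++ E × Residue k j E
  iterate-letter zero    j j<m =
    j ∷ [] , refl , ≤-refl , λ m≤j+0 → ⊥-elim (<⇒≱ j<m (subst (m ≤_) (+-identityʳ j) m≤j+0))
  iterate-letter (suc k) j j<m with m≤n⇒m<n∨m≡n j<m
  ... | inj₁ 1+j<m with iterate-letter k (suc j) 1+j<m
  ...   | E , eq , |E|≤1 , E≡[] = E , (begin
    iterate φ* (φ j ++ []) k
      ≡⟨ cong (λ w → iterate φ* w k) (trans (++-identityʳ (φ j)) (φ-inner 1+j<m)) ⟩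
    iterate φ* (replicate (t (suc j)) 0 ++ suc j ∷ []) k
      ≡⟨ iterate-++ k (replicate (t (suc j)) 0) (suc j ∷ []) ⟩
    iterate φ* (replicate (t (suc j)) 0) k ++ iterate φ* (suc j ∷ []) k
      ≡⟨ cong₂ _++_ (trans (iterate-replicate k (t (suc j)) 0) (cong (_^ʷ t (suc j)) (sym (uw-iterate k)))) eq ⟩
    uw k ^ʷ t (suc j) ++ expand k (ts (suc (suc j)) (m ∸ suc j)) ++ E
      ≡⟨ sym (++-assoc (uw k ^ʷ t (suc j)) _ E) ⟩
    expand (suc k) (ts (suc j) (suc (m ∸ suc j))) ++ E
      ≡⟨ cong (λ r → expand (suc k) (ts (suc j) r) ++ E) (sym (+-∸-assoc 1 (<⇒≤ 1+j<m))) ⟩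
    expand (suc k) (ts (suc j) (m ∸ j)) ++ E ∎) , |E|≤1 , λ m≤j+1+k → E≡[] (subst (m ≤_) (+-suc j k) m≤j+1+k)
    where open ≡-Reasoning
  iterate-letter (suc k) j j<m | inj₂ refl = [] , (begin
    iterate φ* (φ j ++ []) k
      ≡⟨ cong (λ w → iterate φ* w k) (trans (++-identityʳ (φ j)) (φ-last refl)) ⟩
    iterate φ* (replicate (t (suc j)) 0) k
      ≡⟨ trans (iterate-replicate k (t (suc j)) 0) (cong (_^ʷ t (suc j)) (sym (uw-iterate k))) ⟩
    uw k ^ʷ t (suc j)
      ≡⟨ sym (++-identityʳ _) ⟩
    uw k ^ʷ t (suc j) ++ []
      ≡⟨ cong (uw k ^ʷ t (suc j) ++_) (sym (expand-[] k)) ⟩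
    uw k ^ʷ t (suc j) ++ expand k []
      ≡⟨ sym (++-identityʳ _) ⟩
    expand (suc k) (ts (suc j) 1) ++ []
      ≡⟨ cong (λ r → expand (suc k) (ts (suc j) r) ++ []) (sym (m+n∸n≡m 1 j)) ⟩
    expand (suc k) (ts (suc j) (suc j ∸ j)) ++ [] ∎) , z≤n , λ _ → refl
    where open ≡-Reasoning

  uw-expand : 1 ≤ m → ∀ k → Σ Word λ E → uw k ≡ expand k (ts 1 m) ++ E × Residue k 0 E
  uw-expand 1≤m k with iterate-letter k 0 1≤m
  ... | E , eq , res = E , trans (uw-iterate k) eq , res

-- m is written m′ + 2, so that m ∸ 1 and m ∸ 2 reduce to suc m′ and m′.
module PrefixStructure (m′ : ℕ) (t : ℕ → ℕ) (t₁≥2 : 2 ≤ t 1) where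
  m : ℕ
  m = suc (suc m′)

  open Parry m t public
  open Expansion m t public
  open Factors u public

  T₁ : List ℕ
  T₁ = ts 1 m

  t₁′ : ℕ
  t₁′ = t 1 ∸ 1

  ^ʷ-t₁ : ∀ w → w ^ʷ t 1 ≡ w ++ w ^ʷ t₁′
  ^ʷ-t₁ w = cong (w ^ʷ_) (sym (m+[n∸m]≡n (≤-trans (s≤s z≤n) t₁≥2)))

  uw-suc : ∀ k → Σ Word λ E → uw (suc k) ≡ uw k ^ʷ t 1 ++ expand k (ts 2 (suc m′)) ++ E × Residue (suc k) 0 E
  uw-suc k with uw-expand (s≤s z≤n) (suc k)
  ... | E , eq , res = E , trans eq (++-assoc (uw k ^ʷ t 1) _ E) , res

  uw-⊑-suc : ∀ k → uw k ⊑ uw (suc k)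
  uw-⊑-suc k with uw-suc k
  ... | E , eq , _ = uw k ^ʷ t₁′ ++ R , trans eq (trans (cong (_++ R) (^ʷ-t₁ (uw k))) (++-assoc (uw k) (uw k ^ʷ t₁′) R))
    where
    R : Word
    R = expand k (ts 2 (suc m′)) ++ E

  uw-mono : ∀ {a b} → a ≤ b → uw a ⊑ uw b
  uw-mono {a} {b} a≤b with m≤n⇒m<n∨m≡n a≤b
  ... | inj₂ refl = ⊑-refl
  uw-mono {a} {suc b} _ | inj₁ (s≤s a≤b) = ⊑-trans (uw-mono a≤b) (uw-⊑-suc b)

  U-mono : ∀ {a b} → a ≤ b → U a ≤ U b
  U-mono a≤b = ⊑-length (uw-mono a≤b)

  U-positive : ∀ k → 1 ≤ U k
  U-positive k = U-mono {0} {k} z≤n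

  U-pred : ∀ k → suc (U k ∸ 1) ≡ U k
  U-pred k = m+[n∸m]≡n (U-positive k)

  uw²-⊑ : ∀ k → uw k ++ uw k ⊑ uw (suc k)
  uw²-⊑ k with uw-suc k
  ... | E , eq , _ = subst (uw k ++ uw k ⊑_) (sym eq)
                       (⊑-trans (subst (λ w → uw k ++ w ⊑ uw k ^ʷ 2) (++-identityʳ (uw k)) ⊑-refl)
                                (⊑-trans (^ʷ-⊑ (uw k) t₁≥2) (⊑-++ _ _)))

  U-double : ∀ k → U k + U k ≤ U (suc k)
  U-double k = subst (_≤ U (suc k)) (length-++ (uw k)) (⊑-length (uw²-⊑ k))

  k<U : ∀ k → k < U k
  k<U zero    = s≤s z≤n
  k<U (suc k) = <-≤-trans (+-mono-≤-< (U-positive k) (k<U k)) (U-double k)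

  IsPrefix-uw : ∀ n → IsPrefix (uw n)
  IsPrefix-uw n q q<U with n ≤? suc q
  ... | yes n≤1+q = sym (⊑-at (uw-mono n≤1+q) q q<U)
  ... | no  n≰1+q = ⊑-at (uw-mono (<⇒≤ (≰⇒> n≰1+q))) q (<-trans (n<1+n q) (k<U (suc q)))

  Admissible : List ℕ → Set
  Admissible []      = ⊤
  Admissible (c ∷ d) = c ∷ d ≤lex T₁ × Admissible d

  Admissible⇒≤lex : ∀ d → Admissible d → d ≤lex T₁
  Admissible⇒≤lex []      _            = tt
  Admissible⇒≤lex (c ∷ d) (c∷d≤T₁ , _) = c∷d≤T₁

  expand-≤lex-[] : ∀ k d → d ≤lex [] → expand k d ≡ []
  expand-≤lex-[] zero    d        _          = refl
  expand-≤lex-[] (suc k) []       _          = refl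
  expand-≤lex-[] (suc k) (.0 ∷ d) (refl , d≤[]) = expand-≤lex-[] k d d≤[]

  expand-T₁-⊑ : ∀ k → expand k T₁ ⊑ uw k
  expand-T₁-⊑ k with uw-expand (s≤s z≤n) k
  ... | E , eq , _ = E , eq

  -- A leading digit c < t_i wins outright: expand k d ⊑ u_k, so u_k^c (expand k d) ⊑ u_k^(c+1) ⊑ u_k^(t_i).
  expand-⊑ : ∀ k i r d → d ≤lex ts i r → Admissible d → expand k d ⊑ expand k (ts i r)
  expand-⊑ zero    i r       d       _                  _         = ⊑-refl
  expand-⊑ (suc k) i r       []      _                  _         = []⊑ _
  expand-⊑ (suc k) i zero    (c ∷ d) c∷d≤[]             _         =
    subst (_⊑ []) (sym (expand-≤lex-[] (suc k) (c ∷ d) c∷d≤[])) ⊑-refl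
  expand-⊑ (suc k) i (suc r) (c ∷ d) (inj₁ c<tᵢ)        (_ , adm) =
    ⊑-trans (⊑-++⁺ (uw k ^ʷ c) (⊑-trans (expand-⊑ k 1 m d (Admissible⇒≤lex d adm) adm) (expand-T₁-⊑ k)))
      (⊑-trans (subst (uw k ^ʷ c ++ uw k ⊑_) (sym (^ʷ-sucʳ (uw k) c)) ⊑-refl)
               (⊑-trans (^ʷ-⊑ (uw k) c<tᵢ) (⊑-++ _ _)))
  expand-⊑ (suc k) i (suc r) (c ∷ d) (inj₂ (refl , d≤)) (_ , adm) = ⊑-++⁺ (uw k ^ʷ c) (expand-⊑ k (suc i) r d d≤ adm)

  IsPrefix-expand : ∀ k d → Admissible d → IsPrefix (expand k d)
  IsPrefix-expand k d adm =
    IsPrefix-⊑ (⊑-trans (expand-⊑ k 1 m d (Admissible⇒≤lex d adm) adm) (expand-T₁-⊑ k)) (IsPrefix-uw k)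

module SimpleParry (m′ : ℕ) (t : ℕ → ℕ)
  (parry : Parry.IsSimpleParry (suc (suc m′)) t)
  (cond₁ : ∀ i → 2 ≤ i → i ≤ m′ → Parry.mod-seq (suc (suc m′)) t i ≺lex Parry.tail-seq (suc (suc m′)) t 1)
  (cond₂ : t (suc m′) ⊔ t (suc (suc m′)) < t 1) where

  tₘ≥1 : 1 ≤ t (suc (suc m′))
  tₘ≥1 = proj₁ (proj₂ (proj₂ parry))

  tₘ<t₁ : t (suc (suc m′)) < t 1
  tₘ<t₁ = ≤-<-trans (m≤n⊔m (t (suc m′)) _) cond₂

  tₘ₋₁<t₁ : t (suc m′) < t 1
  tₘ₋₁<t₁ = ≤-<-trans (m≤m⊔n _ (t (suc (suc m′)))) cond₂

  t₁≥2 : 2 ≤ t 1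
  t₁≥2 = ≤-trans (s≤s tₘ≥1) tₘ<t₁

  open PrefixStructure m′ t t₁≥2 public

  Admissible-∷ : ∀ {c d} → c < t 1 → Admissible d → Admissible (c ∷ d)
  Admissible-∷ c<t₁ adm = inj₁ c<t₁ , adm

  tail-seq≗ts : ∀ {i r} → i + r ≡ suc m → ∀ j → tail-seq i j ≡ at (ts i r) j
  tail-seq≗ts {i} {r} i+r≡1+m j with j <? r
  ... | yes j<r = trans (if-T (≤⇒≤ᵇ i+j≤m)) (sym (at-ts-< i r j j<r))
    where
    i+j≤m : i + j ≤ m
    i+j≤m = s≤s⁻¹ (subst (suc (i + j) ≤_) i+r≡1+m (subst (_≤ i + r) (+-suc i j) (+-monoʳ-≤ i j<r)))
  ... | no  j≮r = trans (if-¬T (λ h → <⇒≱ m<i+j (≤ᵇ⇒≤ (i + j) m h))) (sym (at-ts-≥ i r j (≮⇒≥ j≮r)))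
    where
    m<i+j : m < i + j
    m<i+j = subst (_≤ i + j) i+r≡1+m (+-monoʳ-≤ i (≮⇒≥ j≮r))

  Admissible-ts : ∀ i r → 1 ≤ i → i + r ≡ suc m → Admissible (ts i r)
  Admissible-ts i zero    _   _        = tt
  Admissible-ts i (suc r) i≥1 i+1+r≡1+m =
    head i≥1 , Admissible-ts (suc i) r (s≤s z≤n) (trans (sym (+-suc i r)) i+1+r≡1+m)
    where
    head : 1 ≤ i → ts i (suc r) ≤lex T₁
    head i≥1 with m≤n⇒m<n∨m≡n i≥1
    ... | inj₂ refl = subst (λ r → ts 1 r ≤lex T₁) (sym (suc-injective i+1+r≡1+m)) (≤lex-refl T₁)
    ... | inj₁ i≥2  = ≺lex⇒≤lex (ts i (suc r)) T₁
      (≺lex-respʳ (tail-seq≗ts refl) (≺lex-respˡ (λ j → sym (tail-seq≗ts i+1+r≡1+m j))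
        (proj₂ (proj₂ (proj₂ parry)) i i≥2 (≤-pred (subst (suc i ≤_) i+1+r≡1+m (m<m+n i z<s))))))

  Admissible-T₁ : Admissible T₁
  Admissible-T₁ = Admissible-ts 1 m ≤-refl refl

  ts++T₁≺mod-seq : ∀ i p → i + p ≡ suc m′ → at (ts i (suc p) ++ T₁) ≺lex mod-seq i
  ts++T₁≺mod-seq i p i+p≡m-1 = p , agree , (subst (_< mod-seq i p) (sym (at-L i (n<1+n p))) below)
    where
    at-L : ∀ i {j} → j < suc p → at (ts i (suc p) ++ T₁) j ≡ t (i + j)
    at-L i {j} j<1+p = trans (at-++ˡ (ts i (suc p)) T₁ j (subst (j <_) (sym (length-ts i (suc p))) j<1+p))
                             (at-ts-< i (suc p) j j<1+p)

    agree : ∀ j → j < p → at (ts i (suc p) ++ T₁) j ≡ mod-seq i j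
    agree j j<p = trans (at-L i (m<n⇒m<1+n j<p)) (sym (if-T (≤⇒≤ᵇ i+j≤m-2)))
      where
      i+j≤m-2 : i + j ≤ m′
      i+j≤m-2 = ≤-pred (subst (suc (i + j) ≤_) i+p≡m-1 (subst (_≤ i + p) (+-suc i j) (+-monoʳ-≤ i j<p)))

    below : t (i + p) < mod-seq i p
    below = subst (t (i + p) <_)
      (sym (trans (if-¬T (λ h → <⇒≱ (subst (m′ <_) (sym i+p≡m-1) ≤-refl) (≤ᵇ⇒≤ (i + p) m′ h)))
                  (if-T (≡⇒≡ᵇ (i + p) (suc m′) i+p≡m-1))))
      (subst (λ k → t (i + p) < suc (t k)) i+p≡m-1 ≤-refl)

  -- t_i ⋯ t_{m-1} t₁ ⋯ t_m is below t_i ⋯ t_{m-2} (t_{m-1}+1) 0^ω, hence below t₁ ⋯ t_m by hypothesis (1);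
  -- for i = m - 1 hypothesis (2) is used instead.
  ts++T₁-≤lex : ∀ i p → 2 ≤ i → i + suc p ≡ m → ts i (suc p) ++ T₁ ≤lex T₁
  ts++T₁-≤lex i zero    _   i+1≡m =
    inj₁ (subst (λ k → t k < t 1) (sym (suc-injective (trans (+-comm 1 i) i+1≡m))) tₘ₋₁<t₁)
  ts++T₁-≤lex i (suc p) i≥2 i+2+p≡m = ≺lex⇒≤lex (ts i (suc (suc p)) ++ T₁) T₁
    (≺lex-respʳ (tail-seq≗ts refl) (≺lex-trans (ts++T₁≺mod-seq i (suc p) i+1+p≡m-1) (cond₁ i i≥2 i≤m-2)))
    where
    i+1+p≡m-1 : i + suc p ≡ suc m′
    i+1+p≡m-1 = suc-injective (trans (sym (+-suc i (suc p))) i+2+p≡m)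
    i≤m-2 : i ≤ m′
    i≤m-2 = ≤-pred (subst (suc i ≤_) i+1+p≡m-1 (m<m+n i z<s))

  Admissible-ts++T₁ : ∀ i r → 2 ≤ i → i + r ≡ m → Admissible (ts i r ++ T₁)
  Admissible-ts++T₁ i zero    _   _        = Admissible-T₁
  Admissible-ts++T₁ i (suc r) i≥2 i+1+r≡m =
    ts++T₁-≤lex i r i≥2 i+1+r≡m , Admissible-ts++T₁ (suc i) r (m≤n⇒m≤1+n i≥2) (trans (sym (+-suc i r)) i+1+r≡m)

  t₁′<t₁ : t₁′ < t 1
  t₁′<t₁ = subst (t₁′ <_) (m+[n∸m]≡n (≤-trans (s≤s z≤n) t₁≥2)) ≤-refl

  -- u_{n+1} = u_n (expand (n+1) X) E,   Z_n = u_{n-1} (expand n Y),   Z_n = u_n (expand (n-m+1) W).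
  X Y W : List ℕ
  X = t₁′ ∷ ts 2 (suc m′)
  Y = t₁′ ∷ ts 2 m′ ++ T₁
  W = (t 1 ∸ t m) ∷ ts 2 (suc m′)

  Admissible-X : Admissible X
  Admissible-X = Admissible-∷ t₁′<t₁ (proj₂ Admissible-T₁)

  Admissible-Y : Admissible Y
  Admissible-Y = Admissible-∷ t₁′<t₁ (Admissible-ts++T₁ 2 m′ ≤-refl refl)

  Admissible-W : Admissible W
  Admissible-W = Admissible-∷ (∸-monoʳ-< {t 1} tₘ≥1 (<⇒≤ tₘ<t₁)) (proj₂ Admissible-T₁)

  periodic-a : ∀ n → Periodic (U n) (U (suc n) ∸ 1)
  periodic-a n with uw-suc n
  ... | E , eq , |E|≤1 , _ = Periodic-≤ bound
      (IsPrefix-periodic (uw n) X′ (IsPrefix-⊑ (E , split) (IsPrefix-uw (suc n))) (IsPrefix-expand (suc n) X Admissible-X))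
    where
    R X′ : Word
    R  = expand n (ts 2 (suc m′))
    X′ = expand (suc n) X

    split : uw (suc n) ≡ (uw n ++ X′) ++ E
    split = begin
      uw (suc n)                         ≡⟨ eq ⟩
      uw n ^ʷ t 1 ++ R ++ E              ≡⟨ cong (_++ R ++ E) (^ʷ-t₁ (uw n)) ⟩
      (uw n ++ uw n ^ʷ t₁′) ++ R ++ E    ≡⟨ ++-assoc (uw n) (uw n ^ʷ t₁′) (R ++ E) ⟩
      uw n ++ uw n ^ʷ t₁′ ++ R ++ E      ≡⟨ cong (uw n ++_) (sym (++-assoc (uw n ^ʷ t₁′) R E)) ⟩
      uw n ++ X′ ++ E                    ≡⟨ sym (++-assoc (uw n) X′ E) ⟩
      (uw n ++ X′) ++ E                  ∎
      where open ≡-Reasoning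

    bound : U (suc n) ∸ 1 ≤ U n + length X′
    bound = subst₂ (λ a b → length a ∸ 1 ≤ b) (sym split) (length-++ (uw n))
                   (length-++-∸1 (uw n ++ X′) E |E|≤1)

  uw-of-≤ : ∀ {n k} → k ≤ n → uw- n k ≡ uw (n ∸ k)
  uw-of-≤ k≤n = if-T (≤⇒≤ᵇ k≤n)

  uw-of-> : ∀ {n k} → n < k → uw- n k ≡ []
  uw-of-> {n} {k} n<k = if-¬T (λ h → <⇒≱ n<k (≤ᵇ⇒≤ k n h))

  block : ℕ → ℕ → Word
  block n i = uw- n (m + i) ^ʷ t (suc i)

  block-++-expand : ∀ n a R → block n a ++ expand (suc n ∸ (m + suc a)) R ≡ expand (suc n ∸ (m + a)) (t (suc a) ∷ R)
  block-++-expand n a R with m + a ≤? n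
  ... | yes m+a≤n = begin
    uw- n (m + a) ^ʷ t (suc a) ++ expand (suc n ∸ (m + suc a)) R
      ≡⟨ cong₂ (λ w k → w ^ʷ t (suc a) ++ expand k R) (uw-of-≤ m+a≤n) (cong (suc n ∸_) (+-suc m a)) ⟩
    expand (suc (n ∸ (m + a))) (t (suc a) ∷ R)
      ≡⟨ cong (λ k → expand k (t (suc a) ∷ R)) (sym (+-∸-assoc 1 m+a≤n)) ⟩
    expand (suc n ∸ (m + a)) (t (suc a) ∷ R) ∎
    where open ≡-Reasoning
  ... | no  m+a≰n = begin
    uw- n (m + a) ^ʷ t (suc a) ++ expand (suc n ∸ (m + suc a)) R
      ≡⟨ cong₂ (λ w k → w ^ʷ t (suc a) ++ expand k R) (uw-of-> (≰⇒> m+a≰n)) (m≤n⇒m∸n≡0 n<m+1+a) ⟩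
    [] ^ʷ t (suc a) ++ []
      ≡⟨ trans (++-identityʳ _) ([]-^ʷ (t (suc a))) ⟩
    []
      ≡⟨ cong (λ k → expand k (t (suc a) ∷ R)) (sym (m≤n⇒m∸n≡0 (≰⇒> m+a≰n))) ⟩
    expand (suc n ∸ (m + a)) (t (suc a) ∷ R) ∎
    where
    open ≡-Reasoning
    n<m+1+a : suc n ≤ m + suc a
    n<m+1+a = subst (suc n ≤_) (sym (+-suc m a)) (m≤n⇒m≤1+n (≰⇒> m+a≰n))

  blocks-expand : ∀ n r a (g : ℕ → ℕ) → (∀ x → g x ≡ a + x) →
                  concat (map (block n) (applyUpTo g r)) ≡ expand (suc n ∸ (m + a)) (ts (suc a) r)
  blocks-expand n zero    a g _  = sym (expand-[] (suc n ∸ (m + a)))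
  blocks-expand n (suc r) a g g≗ =
    trans (cong₂ _++_ (cong (block n) (trans (g≗ 0) (+-identityʳ a)))
                      (blocks-expand n r (suc a) (λ x → g (suc x)) (λ x → trans (g≗ (suc x)) (+-suc a x))))
          (block-++-expand n a (ts (suc (suc a)) r))

  module Block (d : ℕ) where
    n₁ : ℕ
    n₁ = suc m′ + d

    A V : Word
    A = uw n₁ ^ʷ t 1 ++ expand n₁ (ts 2 m′)
    V = expand (suc d) T₁

    uw-m+d : uw (m + d) ≡ expand (m + d) T₁
    uw-m+d with uw-expand (s≤s z≤n) (m + d)
    ... | E , eq , _ , E≡[] = trans eq (trans (cong (expand (m + d) T₁ ++_) (E≡[] (m≤m+n m d))) (++-identityʳ _))

    expand-n₁ : ∀ e → expand n₁ (ts 2 m′ ++ e) ≡ expand n₁ (ts 2 m′) ++ expand (suc d) e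
    expand-n₁ e = trans (expand-++ n₁ (ts 2 m′) e)
      (cong (λ k → expand n₁ (ts 2 m′) ++ expand k e)
            (trans (cong (n₁ ∸_) (length-ts 2 m′)) (trans (cong (_∸ m′) (sym (+-suc m′ d))) (m+n∸m≡n m′ (suc d)))))

    uw-A : uw (m + d) ≡ A ++ uw d ^ʷ t m
    uw-A = begin
      uw (m + d)
        ≡⟨ uw-m+d ⟩
      uw n₁ ^ʷ t 1 ++ expand n₁ (ts 2 (suc m′))
        ≡⟨ cong (λ ds → uw n₁ ^ʷ t 1 ++ expand n₁ ds) (ts-suc 2 m′) ⟩
      uw n₁ ^ʷ t 1 ++ expand n₁ (ts 2 m′ ++ t m ∷ [])
        ≡⟨ cong (uw n₁ ^ʷ t 1 ++_) (expand-n₁ (t m ∷ [])) ⟩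
      uw n₁ ^ʷ t 1 ++ expand n₁ (ts 2 m′) ++ uw d ^ʷ t m ++ expand d []
        ≡⟨ sym (++-assoc (uw n₁ ^ʷ t 1) _ _) ⟩
      A ++ uw d ^ʷ t m ++ expand d []
        ≡⟨ cong (λ w → A ++ uw d ^ʷ t m ++ w) (expand-[] d) ⟩
      A ++ uw d ^ʷ t m ++ []
        ≡⟨ cong (A ++_) (++-identityʳ _) ⟩
      A ++ uw d ^ʷ t m ∎
      where open ≡-Reasoning

    Zw-expand : Zw (m + d) ≡ uw (m + d) ++ expand (suc d) W
    Zw-expand = cong (uw (m + d) ++_) (cong₂ _++_
      (cong (_^ʷ (t 1 ∸ t m)) (trans (uw-of-≤ (m≤m+n m d)) (cong uw (m+n∸m≡n m d))))
      (trans (blocks-expand (m + d) (suc m′) 1 suc (λ _ → refl))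
             (cong (λ k → expand k (ts 2 (suc m′))) (trans (cong (suc (m + d) ∸_) (+-comm m 1)) (m+n∸m≡n m d)))))

    Zw-A++V : Zw (m + d) ≡ A ++ V
    Zw-A++V = begin
      Zw (m + d)
        ≡⟨ Zw-expand ⟩
      uw (m + d) ++ uw d ^ʷ (t 1 ∸ t m) ++ R
        ≡⟨ cong (_++ uw d ^ʷ (t 1 ∸ t m) ++ R) uw-A ⟩
      (A ++ uw d ^ʷ t m) ++ uw d ^ʷ (t 1 ∸ t m) ++ R
        ≡⟨ ++-assoc A _ _ ⟩
      A ++ uw d ^ʷ t m ++ uw d ^ʷ (t 1 ∸ t m) ++ R
        ≡⟨ cong (A ++_) (sym (++-assoc (uw d ^ʷ t m) _ R)) ⟩
      A ++ (uw d ^ʷ t m ++ uw d ^ʷ (t 1 ∸ t m)) ++ R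
        ≡⟨ cong (λ w → A ++ w ++ R) (sym (^ʷ-+ (uw d) (t m) _)) ⟩
      A ++ uw d ^ʷ (t m + (t 1 ∸ t m)) ++ R
        ≡⟨ cong (λ c → A ++ uw d ^ʷ c ++ R) (m+[n∸m]≡n (<⇒≤ tₘ<t₁)) ⟩
      A ++ V ∎
      where
      open ≡-Reasoning
      R : Word
      R = expand d (ts 2 (suc m′))

    Zw-Y : Zw (m + d) ≡ uw n₁ ++ expand (m + d) Y
    Zw-Y = begin
      Zw (m + d)
        ≡⟨ Zw-A++V ⟩
      (uw n₁ ^ʷ t 1 ++ expand n₁ (ts 2 m′)) ++ V
        ≡⟨ cong (λ w → (w ++ expand n₁ (ts 2 m′)) ++ V) (^ʷ-t₁ (uw n₁)) ⟩
      ((uw n₁ ++ uw n₁ ^ʷ t₁′) ++ expand n₁ (ts 2 m′)) ++ V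
        ≡⟨ cong (_++ V) (++-assoc (uw n₁) _ _) ⟩
      (uw n₁ ++ uw n₁ ^ʷ t₁′ ++ expand n₁ (ts 2 m′)) ++ V
        ≡⟨ ++-assoc (uw n₁) _ V ⟩
      uw n₁ ++ (uw n₁ ^ʷ t₁′ ++ expand n₁ (ts 2 m′)) ++ V
        ≡⟨ cong (uw n₁ ++_) (++-assoc (uw n₁ ^ʷ t₁′) _ V) ⟩
      uw n₁ ++ uw n₁ ^ʷ t₁′ ++ expand n₁ (ts 2 m′) ++ V
        ≡⟨ cong (λ w → uw n₁ ++ uw n₁ ^ʷ t₁′ ++ w) (sym (expand-n₁ T₁)) ⟩
      uw n₁ ++ expand (m + d) Y ∎
      where open ≡-Reasoning

    Zw-⊑ : Zw (m + d) ⊑ uw (suc (m + d))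
    Zw-⊑ = subst (_⊑ uw (suc (m + d))) (sym Zw-expand)
      (⊑-trans (⊑-++⁺ (uw (m + d)) (⊑-trans (expand-⊑ (suc d) 1 m W (proj₁ Admissible-W) Admissible-W)
                                  (⊑-trans (expand-T₁-⊑ (suc d)) (uw-mono (s≤s (m≤n+m d (suc m′)))))))
               (uw²-⊑ (m + d)))

    IsPrefix-Zw : IsPrefix (Zw (m + d))
    IsPrefix-Zw = IsPrefix-⊑ Zw-⊑ (IsPrefix-uw (suc (m + d)))

    U≤Z : U (m + d) ≤ Z (m + d)
    U≤Z = ⊑-length (subst (uw (m + d) ⊑_) (sym Zw-expand) (⊑-++ _ _))

    Z≤U : Z (m + d) ≤ U (suc (m + d))
    Z≤U = ⊑-length Zw-⊑

    periodic-b : Periodic (U n₁) (Z (m + d))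
    periodic-b = subst (Periodic (U n₁)) (sym (trans (cong length Zw-Y) (length-++ (uw n₁))))
      (IsPrefix-periodic (uw n₁) (expand (m + d) Y) (subst IsPrefix Zw-Y IsPrefix-Zw) (IsPrefix-expand (m + d) Y Admissible-Y))

    periodic-A : Periodic (length A) (length A + length V)
    periodic-A = IsPrefix-periodic A V (subst IsPrefix Zw-A++V IsPrefix-Zw) (IsPrefix-expand (suc d) T₁ Admissible-T₁)

    periodic-uw-d : Periodic (U d) (t 1 * U d)
    periodic-uw-d = IsPrefix-^ʷ-periodic (uw d) (≤-trans (s≤s z≤n) t₁≥2)
      (IsPrefix-⊑ (⊑-++ (uw d ^ʷ t 1) _) (IsPrefix-expand (suc d) T₁ Admissible-T₁))

    t₁U≤V : t 1 * U d ≤ length V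
    t₁U≤V = subst (_≤ length V) (length-^ʷ (uw d) (t 1)) (⊑-length (⊑-++ (uw d ^ʷ t 1) _))

    U-suc-d≤V : U (suc d) ∸ 1 ≤ length V
    U-suc-d≤V with uw-expand (s≤s z≤n) (suc d)
    ... | E , eq , |E|≤1 , _ = subst (λ w → length w ∸ 1 ≤ length V) (sym eq) (length-++-∸1 V E |E|≤1)

    Z≡A+V : Z (m + d) ≡ length A + length V
    Z≡A+V = trans (cong length Zw-A++V) (length-++ A)

    U≡A+tₘU : U (m + d) ≡ length A + t m * U d
    U≡A+tₘU = trans (cong length uw-A) (trans (length-++ A) (cong (length A +_) (length-^ʷ (uw d) (t m))))

  InΓ : ℕ → ℕ → ℕ → Set
  InΓ a b p = Σ ℕ λ k → a ≤ k × k ≤ b × p ≡ U k ∸ 1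

  InΓ-mono : ∀ {a a′ b b′ p} → a′ ≤ a → b ≤ b′ → InΓ a b p → InΓ a′ b′ p
  InΓ-mono a′≤a b≤b′ (k , a≤k , k≤b , eq) = k , ≤-trans a′≤a a≤k , ≤-trans k≤b b≤b′ , eq

  InΓ-top : ∀ {a b} → a ≤ b → InΓ a b (U b ∸ 1)
  InΓ-top a≤b = _ , a≤b , ≤-refl , refl

  Γ-small : ∀ {n} → suc n ≤ m → Γ n ≡ map (λ k → U k ∸ 1) (upTo (suc n))
  Γ-small 1+n≤m = if-T (≤⇒≤ᵇ 1+n≤m)

  Γ-large : ∀ {n} → m ≤ n → Γ n ≡ map (λ k → U (n ∸ m + suc k) ∸ 1) (upTo m)
  Γ-large {n} m≤n = if-¬T (λ h → <⇒≱ (s≤s m≤n) (≤ᵇ⇒≤ (suc n) m h))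

  U∸1∈Γ-large : ∀ {n} k → m ≤ n → n ∸ m < k → k ≤ n → U k ∸ 1 ∈ Γ n
  U∸1∈Γ-large {n} k m≤n n-m<k k≤n with m≤n⇒∃[o]m+o≡n n-m<k
  ... | j , refl = subst (_∈ Γ n) (cong (λ k → U k ∸ 1) (+-suc (n ∸ m) j))
                     (subst (U (n ∸ m + suc j) ∸ 1 ∈_) (sym (Γ-large m≤n))
                       (∈-map⁺ (λ k → U (n ∸ m + suc k) ∸ 1) (∈-upTo⁺ j<m)))
    where
    j<m : j < m
    j<m = +-cancelˡ-≤ (n ∸ m) (suc j) m (subst₂ _≤_ (sym (+-suc (n ∸ m) j)) (sym (m∸n+n≡m m≤n)) k≤n)

  InΓ⊆Γ : ∀ {a n p} → suc n ≤ a + m → InΓ a n p → p ∈ Γ n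
  InΓ⊆Γ {a} {n} 1+n≤a+m (k , a≤k , k≤n , refl) with suc n ≤? m
  ... | yes 1+n≤m = subst (U k ∸ 1 ∈_) (sym (Γ-small 1+n≤m)) (∈-map⁺ (λ k → U k ∸ 1) (∈-upTo⁺ (s≤s k≤n)))
  ... | no  1+n≰m = U∸1∈Γ-large k m≤n (≤-trans n-m<a a≤k) k≤n
    where
    m≤n : m ≤ n
    m≤n = ≤-pred (≰⇒> 1+n≰m)
    n-m<a : n ∸ m < a
    n-m<a = +-cancelʳ-≤ m _ a (subst (_≤ a + m) (sym (cong suc (m∸n+n≡m m≤n))) 1+n≤a+m)

  Γ⊆InΓ : ∀ {n p} → p ∈ Γ n → InΓ 0 n p
  Γ⊆InΓ {n} {p} p∈Γ with suc n ≤? m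
  ... | yes 1+n≤m with ∈-map⁻ (λ k → U k ∸ 1) (subst (p ∈_) (Γ-small 1+n≤m) p∈Γ)
  ...   | k , k∈ , eq = k , z≤n , ≤-pred (∈-upTo⁻ k∈) , eq
  Γ⊆InΓ {n} {p} p∈Γ | no 1+n≰m with ∈-map⁻ (λ k → U (n ∸ m + suc k) ∸ 1) (subst (p ∈_) (Γ-large m≤n) p∈Γ)
    where
    m≤n : m ≤ n
    m≤n = ≤-pred (≰⇒> 1+n≰m)
  ...   | j , j∈ , eq = n ∸ m + suc j , z≤n ,
                        ≤-trans (+-monoʳ-≤ (n ∸ m) (∈-upTo⁻ j∈)) (≤-reflexive (m∸n+n≡m (≤-pred (≰⇒> 1+n≰m)))) , eq

  U∸1<U : ∀ k → U k ∸ 1 < U k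
  U∸1<U k = subst (U k ∸ 1 <_) (U-pred k) ≤-refl

  Γ-< : ∀ {n ℓ} → U n ≤ ℓ → All (_< ℓ) (Γ n)
  Γ-< {n} {ℓ} U≤ℓ = All.tabulate λ p∈Γ → bound (Γ⊆InΓ p∈Γ)
    where
    bound : ∀ {p} → InΓ 0 n p → p < ℓ
    bound (k , _ , k≤n , refl) = <-≤-trans (U∸1<U k) (≤-trans (U-mono k≤n) U≤ℓ)

  U-pred-periodic : ∀ k {N} → Periodic (U k) N → Periodic (suc (U k ∸ 1)) N
  U-pred-periodic k = subst (λ p → Periodic p _) (sym (U-pred k))

  attractor-a : ∀ n {ℓ} → U n ∸ 1 ≤ ℓ → ℓ ≤ U (suc n) ∸ 1 → Attractor ℓ (InΓ 0 n)
  attractor-a-start : ∀ n → Attractor (U n ∸ 1) (InΓ 0 n)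

  attractor-a n = Attractor-extend (attractor-a-start n) (InΓ-top z≤n) ≤-refl (U-pred-periodic n (periodic-a n))

  attractor-a-start zero    = Attractor-zero
  attractor-a-start (suc n) = Attractor-mono (InΓ-mono ≤-refl (n≤1+n n))
                                (attractor-a n (∸-monoˡ-≤ 1 (U-mono (n≤1+n n))) ≤-refl)

  b-start : ℕ → ℕ
  b-start zero    = U (suc m′) ∸ 1
  b-start (suc d) = Z (m + d)

  b-start≤U : ∀ d → b-start d ≤ U (m + d)
  b-start≤U zero    = ≤-trans (m∸n≤m _ 1) (U-mono (≤-trans (n≤1+n _) (m≤m+n m 0)))
  b-start≤U (suc d) = subst (λ k → Z (m + d) ≤ U k) (sym (+-suc m d)) (Block.Z≤U d)

  attractor-b : ∀ d {ℓ} → b-start d ≤ ℓ → ℓ ≤ Z (m + d) → Attractor ℓ (InΓ d (suc m′ + d))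
  attractor-c : ∀ d → Attractor (Z (m + d)) (InΓ (suc d) (m + d))
  attractor-b-start : ∀ d → Attractor (b-start d) (InΓ d (suc m′ + d))

  attractor-b d = Attractor-extend (attractor-b-start d) (InΓ-top (m≤n+m d (suc m′))) (last≤b-start d)
                                   (U-pred-periodic (suc m′ + d) (Block.periodic-b d))
    where
    last≤b-start : ∀ d → U (suc m′ + d) ∸ 1 ≤ b-start d
    last≤b-start zero    = ≤-reflexive (cong (λ k → U k ∸ 1) (+-identityʳ (suc m′)))
    last≤b-start (suc d) = ≤-trans (m∸n≤m _ 1) (subst (λ k → U k ≤ Z (m + d)) (sym (+-suc (suc m′) d)) (Block.U≤Z d))

  attractor-b-start zero    = Attractor-mono (InΓ-mono ≤-refl (≤-reflexive (sym (+-identityʳ (suc m′)))))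
                                (attractor-a (suc m′) ≤-refl (∸-monoˡ-≤ 1 (U-mono (n≤1+n (suc m′)))))
  attractor-b-start (suc d) = Attractor-mono (InΓ-mono ≤-refl (≤-reflexive (sym (+-suc (suc m′) d)))) (attractor-c d)

  -- U_n - 1 = |A| + (U_d - 1) + (t_m - 1) U_d, where n = m + d.
  attractor-c d = Attractor-relocate (t m ∸ 1) (attractor-b d (b-start≤Z) ≤-refl) InΓ-step
    (suc d , ≤-refl , s≤s (m≤n+m d (suc m′)) , refl) (∸-monoˡ-≤ 1 (U-mono (n≤1+n d))) U-suc-d≤V
    periodic-uw-d (slide-bound (t m) (U d) (t 1) tₘ≥1 tₘ<t₁) t₁U≤V
    periodic-A (≤-reflexive (sym Z≡A+V))
    (m + d , s≤s (m≤n+m d (suc m′)) , ≤-refl ,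
     sym (trans (cong (_∸ 1) U≡A+tₘU) (∸1-split (length A) (t m) (U d) tₘ≥1 (U-positive d))))
    where
    open Block d

    b-start≤Z : b-start d ≤ Z (m + d)
    b-start≤Z = ≤-trans (b-start≤U d) U≤Z

    InΓ-step : ∀ {p} → InΓ d n₁ p → InΓ (suc d) (m + d) p ⊎ p ≡ U d ∸ 1
    InΓ-step (k , d≤k , k≤n₁ , refl) with m≤n⇒m<n∨m≡n d≤k
    ... | inj₁ d<k  = inj₁ (k , d<k , ≤-trans k≤n₁ (n≤1+n n₁) , refl)
    ... | inj₂ refl = inj₂ refl

    slide-bound : ∀ b c e → 1 ≤ b → b < e → c ∸ 1 + (b ∸ 1) * c + c ≤ e * c
    slide-bound (suc b) c e _ b<e = ≤-trans (+-monoˡ-≤ c (+-monoˡ-≤ (b * c) (m∸n≤m c 1)))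
      (≤-trans (≤-reflexive (unfold b c)) (*-monoˡ-≤ c b<e))
      where
      unfold : ∀ b c → c + b * c + c ≡ suc (suc b) * c
      unfold = solve-∀

    ∸1-split : ∀ a b c → 1 ≤ b → 1 ≤ c → a + b * c ∸ 1 ≡ a + (c ∸ 1 + (b ∸ 1) * c)
    ∸1-split a (suc b) (suc c) _ _ = cong (_∸ 1) (+-suc a (c + b * suc c))

  toIsAttractor : ∀ {ℓ n a} → suc n ≤ a + m → U n ≤ ℓ → Attractor ℓ (InΓ a n) → IsAttractor (prefix ℓ) (Γ n)
  toIsAttractor 1+n≤a+m U≤ℓ = Attractor⇒IsAttractor (Γ-< U≤ℓ) (InΓ⊆Γ 1+n≤a+m)

  part-a : (n : ℕ) → n ≤ m ∸ 1 → (ℓ : ℕ) → U n ≤ ℓ → ℓ ≤ U (suc n) ∸ 1 → IsAttractor (prefix ℓ) (Γ n)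
  part-a n n≤m-1 ℓ U≤ℓ ℓ≤ = toIsAttractor (s≤s n≤m-1) U≤ℓ (attractor-a n (≤-trans (m∸n≤m (U n) 1) U≤ℓ) ℓ≤)

  part-b : (n : ℕ) → m ≤ n → (ℓ : ℕ) → U n ≤ ℓ → ℓ ≤ Z n → IsAttractor (prefix ℓ) (Γ (n ∸ 1))
  part-b n m≤n ℓ U≤ℓ ℓ≤Z with m≤n⇒∃[o]m+o≡n m≤n
  ... | d , refl = toIsAttractor (≤-reflexive (+-comm m d)) (≤-trans (U-mono (n≤1+n (suc m′ + d))) U≤ℓ)
                                 (attractor-b d (≤-trans (b-start≤U d) U≤ℓ) ℓ≤Z)

  part-c : (n : ℕ) → m ≤ n → (ℓ : ℕ) → Z n ≤ ℓ → ℓ ≤ U (suc n) → IsAttractor (prefix ℓ) (Γ n)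
  part-c n m≤n ℓ Z≤ℓ ℓ≤U with m≤n⇒∃[o]m+o≡n m≤n
  ... | d , refl = toIsAttractor (s≤s (≤-reflexive (+-comm m d))) (≤-trans (Block.U≤Z d) Z≤ℓ)
    (Attractor-mono (InΓ-mono ≤-refl (≤-reflexive (+-suc (suc m′) d)))
      (attractor-b (suc d) Z≤ℓ (≤-trans ℓ≤U (subst (λ k → U k ≤ Z (m + suc d)) (+-suc m d) (Block.U≤Z (suc d))))))

theorem4p19 :
    (m : ℕ) (t : ℕ → ℕ) →
    Parry.IsSimpleParry m t →
    ((i : ℕ) → 2 ≤ i → i ≤ m ∸ 2 → Parry.mod-seq m t i ≺lex Parry.tail-seq m t 1) →
    (t (m ∸ 1) ⊔ t m < t 1) →
    ((n : ℕ) → n ≤ m ∸ 1 → (ℓ : ℕ) → Parry.U m t n ≤ ℓ → ℓ ≤ Parry.U m t (suc n) ∸ 1 →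
        IsAttractor (Parry.prefix m t ℓ) (Parry.Γ m t n))
    × ((n : ℕ) → m ≤ n → (ℓ : ℕ) → Parry.U m t n ≤ ℓ → ℓ ≤ Parry.Z m t n →
        IsAttractor (Parry.prefix m t ℓ) (Parry.Γ m t (n ∸ 1)))
    × ((n : ℕ) → m ≤ n → (ℓ : ℕ) → Parry.Z m t n ≤ ℓ → ℓ ≤ Parry.U m t (suc n) →
        IsAttractor (Parry.prefix m t ℓ) (Parry.Γ m t n))
theorem4p19 zero             t (() , _) _ _
theorem4p19 (suc zero)       t (s≤s () , _) _ _
theorem4p19 (suc (suc m′)) t parry cond₁ cond₂ = part-a , part-b , part-c
  where open SimpleParry m′ t parry cond₁ cond₂
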